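{- Let $n \geq 1$ and let $G$ be the sibling tree $ST_n$. Then the locating-total domination number of $G$ is $$\gamma^{L}_t(G) = \begin{cases} \frac{1}{7}(2^{n+3}-1) & \text{if } n\equiv 0 \pmod 3,\\ \frac{1}{7}(2^{n+3}-2) & \text{if } n\equiv 1 \pmod 3,\\ \frac{1}{7}(2^{n+3}-4) & \text{if } n\equiv 2 \pmod 3.\end{cases}$$
   Context: The sibling tree $ST_n$ has vertex set $\{1,2,\dots,2^{n+1}-1\}$; its edges are the edges of the complete binary tree of height $n$ in which vertex $x$ has children $2x$ and $2x+1$ (root $1$ at level $0$; vertex $v$ is at level $i$ iff $2^i\le v\le 2^{i+1}-1$), together with the sibling edges $\{2x,2x+1\}$ for every $x$ with $1\le x\le 2^n-1$. A locating-total dominating set of $G$ is a set $S\subseteq V(G)$ such that every vertex of $V(G)$ is adjacent to some vertex of $S$, and for every two distinct vertices $u,v\in V(G)\setminus S$, $N(u)\cap S\neq N(v)\cap S$ (open neighborhoods). $\gamma^{L}_t(G)$ is the minimum cardinality of a locating-total dominating set. -}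

module Defs where

open import Data.Nat using (ℕ; zero; suc; _+_; _*_; _∸_; _^_; _≤_)
open import Data.Nat.DivMod using (_/_; _%_)
open import Data.Fin using (Fin; toℕ)
open import Data.Fin.Subset using (Subset; _∈_; _∉_; ∣_∣)
open import Data.Product using (Σ; ∃; _×_)
open import Data.Sum using (_⊎_)
open import Relation.Nullary using (¬_)
open import Relation.Binary.PropositionalEquality using (_≡_; _≢_)
open import Function.Bundles using (_⇔_)

order : ℕ → ℕ
order n = 2 ^ (suc n) ∸ 1

-- Vertex of ST_n : an element i of Fin (order n), representing the
-- vertex label (toℕ i + 1) ∈ {1, …, 2^(n+1) - 1}.
Vertex : ℕ → Set
Vertex n = Fin (order n)

label : {n : ℕ} → Vertex n → ℕ
label i = suc (toℕ i)

ChildOf : ℕ → ℕ → Set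
ChildOf y x = (y ≡ 2 * x) ⊎ (y ≡ 2 * x + 1)

-- Sibling edge {2x, 2x+1} with 1 ≤ x (the upper bound x ≤ 2^n - 1 is
-- automatic for labels in range).
SiblingPair : ℕ → ℕ → Set
SiblingPair a b = ∃ λ x → (1 ≤ x) × (a ≡ 2 * x) × (b ≡ 2 * x + 1)

AdjL : ℕ → ℕ → Set
AdjL u v = ChildOf u v ⊎ ChildOf v u ⊎ SiblingPair u v ⊎ SiblingPair v u

Adj : (n : ℕ) → Vertex n → Vertex n → Set
Adj n u v = AdjL (label {n} u) (label {n} v)

IsLocTotDom : (n : ℕ) → Subset (order n) → Set
IsLocTotDom n S =
  ((v : Vertex n) → ∃ λ u → (u ∈ S) × Adj n v u)
  ×
  ((u v : Vertex n) → u ≢ v → u ∉ S → v ∉ S →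
     ¬ ((w : Vertex n) → w ∈ S → (Adj n u w ⇔ Adj n v w)))

LocTotDomNumber : (n : ℕ) → ℕ → Set
LocTotDomNumber n k =
  (∃ λ S → IsLocTotDom n S × ∣ S ∣ ≡ k)
  × ((S : Subset (order n)) → IsLocTotDom n S → k ≤ ∣ S ∣)

correction : ℕ → ℕ
correction r with r
... | 0 = 1
... | 1 = 2
... | _ = 4

formula : ℕ → ℕ
formula n = (2 ^ (n + 3) ∸ correction (n % 3)) / 7

module Submission where

-- Let β k = (2^(3k+4) - 2)/7 (β 0 = 2, β (k+1) = 2 + 8 β k).
-- Lower bound: in every block (a vertex, its children, its grandchildren) a locating-total
-- dominating set has at least two vertices, since the two children must be dominated and
-- must not have the parent as their only neighbour in S.  Peeling off blocks, every vertex at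
-- height 3k+1 has at least β k vertices of S below it, which gives β k, 2 β k and 4 β k + 1
-- at the root for n = 3k+1, 3k+2, 3k+3.  Upper bound: select, level by level from the leaves,
-- the left children / nothing / everything, periodically, plus vertex 2 when n ≡ 0 (mod 3);
-- this set is locating-total dominating and has exactly that size.

open import Defs
open import Data.Nat using (ℕ; zero; suc; _+_; _*_; _∸_; _^_; _≤_; _<_; z≤n; s≤s; _≤?_; _≟_; ⌊_/2⌋; _≡ᵇ_)
open import Data.Nat.Properties
open import Data.Nat.Logarithm
  using (⌊log₂_⌋; ⌊log₂⌋-mono-≤; ⌊log₂⌊n/2⌋⌋≡⌊log₂n⌋∸1; ⌊log₂[2*b]⌋≡1+⌊log₂b⌋; ⌊log₂[2^n]⌋≡n)
open import Data.Nat.Tactic.RingSolver using (solve-∀)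
open import Data.Nat.DivMod using (_/_; _%_; [m+kn]%n≡m%n; m*n/n≡m)
open import Data.Product using (∃; _×_; _,_; proj₁; proj₂)
open import Data.Sum using (_⊎_; inj₁; inj₂) renaming (map to ⊎-map)
open import Data.Empty using (⊥; ⊥-elim)
open import Relation.Nullary using (¬_; yes; no)
open import Relation.Binary.PropositionalEquality
open import Data.Bool using (Bool; true; false; not; _∨_; _∧_)
open import Data.Bool.Properties using (∨-conicalˡ; ∨-identityʳ; ∨-zeroʳ; ∧-zeroʳ)
open import Data.Fin using (Fin; toℕ; fromℕ<) renaming (zero to fz; suc to fs)
open import Data.Fin.Properties using (toℕ-fromℕ<; toℕ<n; toℕ-injective)
open import Data.Fin.Subset using (Subset; _∈_; _∉_; ∣_∣)
open import Data.Vec using ([]; _∷_; tabulate; here; there)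
open import Function.Bundles using (_⇔_; mk⇔; Equivalence)
open import Function.Base using (_∘′_)

-- Labels are natural numbers and the children of x are 2x and 2x+1.  The library states
-- parity facts for suc (2 * b); odd-form and double-suc convert between the two forms.
odd-form : ∀ b → 2 * b + 1 ≡ suc (2 * b)
odd-form b = +-comm (2 * b) 1

double-suc : ∀ c → 2 * suc c ≡ suc (suc (2 * c))
double-suc = solve-∀

even≢odd′ : ∀ a b → 2 * a ≢ 2 * b + 1
even≢odd′ a b e = even≢odd a b (trans e (odd-form b))

double-injective : ∀ {a b} → 2 * a ≡ 2 * b → a ≡ b
double-injective {a} {b} = *-cancelˡ-≡ a b 2

odd-injective : ∀ {a b} → 2 * a + 1 ≡ 2 * b + 1 → a ≡ b
odd-injective {a} {b} e = double-injective (+-cancelʳ-≡ 1 (2 * a) (2 * b) e)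

x≤2x : ∀ x → x ≤ 2 * x
x≤2x x = m≤m+n x (x + 0)

x≤2x+1 : ∀ x → x ≤ 2 * x + 1
x≤2x+1 x = ≤-trans (x≤2x x) (m≤m+n (2 * x) 1)

x<2x : ∀ x → 1 ≤ x → x < 2 * x
x<2x x p = m<m+n x (subst (1 ≤_) (sym (+-identityʳ x)) p)

x<2x+1 : ∀ x → x < 2 * x + 1
x<2x+1 x = subst (x <_) (sym (odd-form x)) (s≤s (x≤2x x))

1≤2x : ∀ {x} → 1 ≤ x → 1 ≤ 2 * x
1≤2x {x} p = ≤-trans p (x≤2x x)

1≤2x+1 : ∀ x → 1 ≤ 2 * x + 1
1≤2x+1 x = m≤n+m 1 (2 * x)

halve : ∀ v → ∃ λ c → v ≡ 2 * c ⊎ v ≡ 2 * c + 1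
halve zero = 0 , inj₁ refl
halve (suc v) with halve v
... | c , inj₁ e = c , inj₂ (trans (cong suc e) (sym (odd-form c)))
... | c , inj₂ e = suc c , inj₁ (trans (cong suc (trans e (odd-form c))) (sym (double-suc c)))

adj-sym : ∀ {u v} → AdjL u v → AdjL v u
adj-sym (inj₁ a) = inj₂ (inj₁ a)
adj-sym (inj₂ (inj₁ a)) = inj₁ a
adj-sym (inj₂ (inj₂ (inj₁ a))) = inj₂ (inj₂ (inj₂ a))
adj-sym (inj₂ (inj₂ (inj₂ a))) = inj₂ (inj₂ (inj₁ a))

adj-irrefl : ∀ y → 1 ≤ y → ¬ AdjL y y
adj-irrefl y p (inj₁ (inj₁ e)) = <⇒≢ (x<2x y p) e
adj-irrefl y p (inj₁ (inj₂ e)) = <⇒≢ (x<2x+1 y) e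
adj-irrefl y p (inj₂ (inj₁ (inj₁ e))) = <⇒≢ (x<2x y p) e
adj-irrefl y p (inj₂ (inj₁ (inj₂ e))) = <⇒≢ (x<2x+1 y) e
adj-irrefl y p (inj₂ (inj₂ (inj₁ (x , _ , e₁ , e₂)))) = even≢odd′ x x (trans (sym e₁) e₂)
adj-irrefl y p (inj₂ (inj₂ (inj₂ (x , _ , e₁ , e₂)))) = even≢odd′ x x (trans (sym e₁) e₂)

nbr-even : ∀ c w → AdjL (2 * c) w →
  w ≡ c ⊎ w ≡ 2 * c + 1 ⊎ w ≡ 2 * (2 * c) ⊎ w ≡ 2 * (2 * c) + 1
nbr-even c w (inj₁ (inj₁ e)) = inj₁ (sym (double-injective e))
nbr-even c w (inj₁ (inj₂ e)) = ⊥-elim (even≢odd′ c w e)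
nbr-even c w (inj₂ (inj₁ (inj₁ e))) = inj₂ (inj₂ (inj₁ e))
nbr-even c w (inj₂ (inj₁ (inj₂ e))) = inj₂ (inj₂ (inj₂ e))
nbr-even c w (inj₂ (inj₂ (inj₁ (x , _ , e₁ , e₂)))) = inj₂ (inj₁ (trans e₂ (cong (_+ 1) (sym e₁))))
nbr-even c w (inj₂ (inj₂ (inj₂ (x , _ , e₁ , e₂)))) = ⊥-elim (even≢odd′ c x e₂)

nbr-odd : ∀ c w → AdjL (2 * c + 1) w →
  w ≡ c ⊎ w ≡ 2 * c ⊎ w ≡ 2 * (2 * c + 1) ⊎ w ≡ 2 * (2 * c + 1) + 1
nbr-odd c w (inj₁ (inj₁ e)) = ⊥-elim (even≢odd′ w c (sym e))
nbr-odd c w (inj₁ (inj₂ e)) = inj₁ (sym (odd-injective e))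
nbr-odd c w (inj₂ (inj₁ (inj₁ e))) = inj₂ (inj₂ (inj₁ e))
nbr-odd c w (inj₂ (inj₁ (inj₂ e))) = inj₂ (inj₂ (inj₂ e))
nbr-odd c w (inj₂ (inj₂ (inj₁ (x , _ , e₁ , e₂)))) = ⊥-elim (even≢odd′ x c (sym e₁))
nbr-odd c w (inj₂ (inj₂ (inj₂ (x , _ , e₁ , e₂)))) =
  inj₂ (inj₁ (trans e₁ (cong (2 *_) (odd-injective {x} {c} (sym e₂)))))

nbr-root : ∀ w → 1 ≤ w → AdjL 1 w → w ≡ 2 ⊎ w ≡ 3
nbr-root w p a with nbr-odd 0 w a
... | inj₁ refl = ⊥-elim (1+n≰n p)
... | inj₂ (inj₁ refl) = ⊥-elim (1+n≰n p)
... | inj₂ (inj₂ (inj₁ e)) = inj₁ e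
... | inj₂ (inj₂ (inj₂ e)) = inj₂ e

-- Two siblings 2x, 2x+1 have exactly one common neighbour, their parent x: any other one
-- would lie both in {2x+1, 4x, 4x+1} and in {2x, 4x+2, 4x+3}, which are disjoint.
common-nbr-siblings : ∀ x y → 1 ≤ x → AdjL y (2 * x) → AdjL y (2 * x + 1) → y ≡ x
common-nbr-siblings x y px a₁ a₂ with nbr-even x y (adj-sym a₁) | nbr-odd x y (adj-sym a₂)
... | inj₁ e | _ = e
... | inj₂ _ | inj₁ e = e
... | inj₂ (inj₁ A) | inj₂ (inj₁ B) = ⊥-elim (even≢odd′ x x (trans (sym B) A))
... | inj₂ (inj₁ A) | inj₂ (inj₂ (inj₁ B)) = ⊥-elim (even≢odd′ (2 * x + 1) x (trans (sym B) A))
... | inj₂ (inj₁ A) | inj₂ (inj₂ (inj₂ B)) = ⊥-elim (<⇒≢ (x<2x+1 x) (odd-injective (trans (sym A) B)))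
... | inj₂ (inj₂ (inj₁ A)) | inj₂ (inj₁ B) = ⊥-elim (<⇒≢ (x<2x x px) (double-injective (trans (sym B) A)))
... | inj₂ (inj₂ (inj₁ A)) | inj₂ (inj₂ (inj₁ B)) = ⊥-elim (even≢odd′ x x (double-injective (trans (sym A) B)))
... | inj₂ (inj₂ (inj₁ A)) | inj₂ (inj₂ (inj₂ B)) = ⊥-elim (even≢odd′ (2 * x) (2 * x + 1) (trans (sym A) B))
... | inj₂ (inj₂ (inj₂ A)) | inj₂ (inj₁ B) = ⊥-elim (even≢odd′ x (2 * x) (trans (sym B) A))
... | inj₂ (inj₂ (inj₂ A)) | inj₂ (inj₂ (inj₁ B)) = ⊥-elim (even≢odd′ (2 * x + 1) (2 * x) (trans (sym B) A))
... | inj₂ (inj₂ (inj₂ A)) | inj₂ (inj₂ (inj₂ B)) = ⊥-elim (even≢odd′ x x (odd-injective (trans (sym A) B)))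

nbr-even-≥ : ∀ z w → AdjL (2 * z) w → z ≤ w
nbr-even-≥ z w a with nbr-even z w a
... | inj₁ refl = ≤-refl
... | inj₂ (inj₁ refl) = x≤2x+1 z
... | inj₂ (inj₂ (inj₁ refl)) = ≤-trans (x≤2x z) (x≤2x (2 * z))
... | inj₂ (inj₂ (inj₂ refl)) = ≤-trans (x≤2x z) (x≤2x+1 (2 * z))

nbr-odd-≥ : ∀ z w → AdjL (2 * z + 1) w → z ≤ w
nbr-odd-≥ z w a with nbr-odd z w a
... | inj₁ refl = ≤-refl
... | inj₂ (inj₁ refl) = x≤2x z
... | inj₂ (inj₂ (inj₁ refl)) = ≤-trans (x≤2x+1 z) (x≤2x (2 * z + 1))
... | inj₂ (inj₂ (inj₂ refl)) = ≤-trans (x≤2x+1 z) (x≤2x+1 (2 * z + 1))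

common-nbr-parent-left : ∀ c y → 1 ≤ c → AdjL y c → AdjL y (2 * c) → y ≡ 2 * c + 1
common-nbr-parent-left c y pc a₁ a₂ with nbr-even c y (adj-sym a₂)
... | inj₁ refl = ⊥-elim (adj-irrefl c pc a₁)
... | inj₂ (inj₁ e) = e
... | inj₂ (inj₂ (inj₁ refl)) = ⊥-elim (<⇒≱ (x<2x c pc) (nbr-even-≥ (2 * c) c a₁))
... | inj₂ (inj₂ (inj₂ refl)) = ⊥-elim (<⇒≱ (x<2x c pc) (nbr-odd-≥ (2 * c) c a₁))

level : ℕ → ℕ
level v = ⌊log₂ v ⌋

level-1 : level 1 ≡ 0
level-1 = ⌊log₂[2^n]⌋≡n 0

level-double : ∀ x → 1 ≤ x → level (2 * x) ≡ suc (level x)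
level-double (suc x) _ = ⌊log₂[2*b]⌋≡1+⌊log₂b⌋ (suc x)

half-odd : ∀ x → ⌊ 2 * x + 1 /2⌋ ≡ x
half-odd zero = refl
half-odd (suc x) = trans (cong ⌊_/2⌋ (shift x)) (cong suc (half-odd x))
  where
  shift : ∀ x → 2 * suc x + 1 ≡ suc (suc (2 * x + 1))
  shift = solve-∀

level-double+1 : ∀ x → 1 ≤ x → level (2 * x + 1) ≡ suc (level x)
level-double+1 x px = begin
  level (2 * x + 1)             ≡⟨ sym (m+[n∸m]≡n positive) ⟩
  suc (level (2 * x + 1) ∸ 1)   ≡⟨ cong suc (sym (⌊log₂⌊n/2⌋⌋≡⌊log₂n⌋∸1 (2 * x + 1))) ⟩
  suc (level ⌊ 2 * x + 1 /2⌋)   ≡⟨ cong (suc ∘′ level) (half-odd x) ⟩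
  suc (level x)                 ∎
  where
  open ≡-Reasoning
  positive : 1 ≤ level (2 * x + 1)
  positive = ≤-trans (s≤s z≤n)
    (subst (_≤ level (2 * x + 1)) (level-double x px) (⌊log₂⌋-mono-≤ (m≤m+n (2 * x) 1)))

suc-order : ∀ n → suc (order n) ≡ 2 ^ suc n
suc-order n = m+[n∸m]≡n (m^n>0 2 (suc n))

1≤order : ∀ n → 1 ≤ order n
1≤order n = ∸-monoˡ-≤ 1 (*-monoʳ-≤ 2 (m^n>0 2 n))

order-suc : ∀ n → order (suc n) ≡ 2 * order n + 1
order-suc n = double-pred (2 ^ suc n) (m^n>0 2 (suc n))
  where
  unfold : ∀ p → p + suc (p + 0) ≡ 2 * p + 1
  unfold = solve-∀
  double-pred : ∀ P → 1 ≤ P → 2 * P ∸ 1 ≡ 2 * (P ∸ 1) + 1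
  double-pred (suc p) _ = unfold p

two≤order : ∀ n → 1 ≤ n → 2 ≤ order n
two≤order (suc m) _ = subst (2 ≤_) (sym (order-suc m)) (+-monoˡ-≤ 1 (≤-trans (1≤order m) (x≤2x (order m))))

level-order : ∀ n → level (order n) ≡ n
level-order zero = level-1
level-order (suc n) = begin
  level (order (suc n))      ≡⟨ cong level (order-suc n) ⟩
  level (2 * order n + 1)    ≡⟨ level-double+1 (order n) (1≤order n) ⟩
  suc (level (order n))      ≡⟨ cong suc (level-order n) ⟩
  suc n                      ∎
  where open ≡-Reasoning

in-range⇒level≤ : ∀ n v → v ≤ order n → level v ≤ n
in-range⇒level≤ n v p = subst (level v ≤_) (level-order n) (⌊log₂⌋-mono-≤ p)

beyond⇒level> : ∀ n v → order n < v → n < level v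
beyond⇒level> n v p =
  subst (_≤ level v) (⌊log₂[2^n]⌋≡n (suc n)) (⌊log₂⌋-mono-≤ (subst (_≤ v) (suc-order n) p))

level≤⇒in-range : ∀ n v → level v ≤ n → v ≤ order n
level≤⇒in-range n v p with v ≤? order n
... | yes q = q
... | no q = ⊥-elim (≤⇒≯ p (beyond⇒level> n v (≰⇒> q)))

-- ReachesLevel m e x: x is positive and its descendants at depth e lie on level m.
-- ReachesLevel n e x says that x is a vertex of ST_n at height e (e levels above the leaves).
ReachesLevel : ℕ → ℕ → ℕ → Set
ReachesLevel m e x = 1 ≤ x × level x + e ≡ m

reaches-children : ∀ {m e x} → ReachesLevel m (suc e) x →
  ReachesLevel m e (2 * x) × ReachesLevel m e (2 * x + 1)
reaches-children {m} {e} {x} (px , h) =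
  (1≤2x px , one-level-down {2 * x} (level-double x px)) ,
  (1≤2x+1 x , one-level-down {2 * x + 1} (level-double+1 x px))
  where
  one-level-down : ∀ {y} → level y ≡ suc (level x) → level y + e ≡ m
  one-level-down eq = trans (cong (_+ e) eq) (trans (sym (+-suc (level x) e)) h)

reaches-root : ∀ n → ReachesLevel n n 1
reaches-root n = s≤s z≤n , cong (_+ n) level-1

reaches-in-range : ∀ {n e x} → ReachesLevel n e x → x ≤ order n
reaches-in-range {n} {e} {x} (_ , h) = level≤⇒in-range n x (subst (level x ≤_) h (m≤m+n (level x) e))

reaches-beyond : ∀ {n y} → ReachesLevel (suc n) 0 y → order n < y
reaches-beyond {n} {y} (_ , h) with y ≤? order n
... | yes q = ⊥-elim (1+n≰n (subst (_≤ n) (trans (sym (+-identityʳ (level y))) h) (in-range⇒level≤ n y q)))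
... | no q = ≰⇒> q

child-in-range : ∀ n v → 1 ≤ v → level v < n → 2 * v + 1 ≤ order n
child-in-range n v p lt = level≤⇒in-range n (2 * v + 1) (subst (_≤ n) (sym (level-double+1 v p)) lt)

⟦_⟧ : Bool → ℕ
⟦ true ⟧ = 1
⟦ false ⟧ = 0

-- memberAt S k: membership of the vertex with index k (false beyond the end of S).
memberAt : ∀ {m} → Subset m → ℕ → Bool
memberAt [] _ = false
memberAt (b ∷ S) zero = b
memberAt (b ∷ S) (suc k) = memberAt S k

inS : ∀ {m} → Subset m → ℕ → Bool
inS S l = memberAt S (l ∸ 1)

∈⇒memberAt : ∀ {m} {S : Subset m} {i} → i ∈ S → memberAt S (toℕ i) ≡ true
∈⇒memberAt here = refl
∈⇒memberAt (there p) = ∈⇒memberAt p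

memberAt⇒∈ : ∀ {m} (S : Subset m) i → memberAt S (toℕ i) ≡ true → i ∈ S
memberAt⇒∈ (.true ∷ S) fz refl = here
memberAt⇒∈ (b ∷ S) (fs i) e = there (memberAt⇒∈ S i e)

∉⇒memberAt : ∀ {m} (S : Subset m) i → i ∉ S → memberAt S (toℕ i) ≡ false
∉⇒memberAt S i i∉S with memberAt S (toℕ i) in eq
... | true = ⊥-elim (i∉S (memberAt⇒∈ S i eq))
... | false = refl

memberAt-beyond : ∀ {m} (S : Subset m) k → m ≤ k → memberAt S k ≡ false
memberAt-beyond [] k _ = refl
memberAt-beyond (b ∷ S) (suc k) (s≤s p) = memberAt-beyond S k p

memberAt-tabulate : ∀ {m} (F : Fin m → Bool) k (p : k < m) → memberAt (tabulate F) k ≡ F (fromℕ< p)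
memberAt-tabulate F zero (s≤s _) = refl
memberAt-tabulate F (suc k) (s≤s p) = memberAt-tabulate (F ∘′ fs) k p

record InRange (n l : ℕ) : Set where
  constructor in-range
  field
    positive : 1 ≤ l
    bounded  : l ≤ order n

vertexAt : ∀ {n} l → InRange n l → Vertex n
vertexAt (suc k) (in-range _ p) = fromℕ< p

label-vertexAt : ∀ {n} l (r : InRange n l) → label {n} (vertexAt l r) ≡ l
label-vertexAt (suc k) (in-range _ p) = cong suc (toℕ-fromℕ< p)

label-in-range : ∀ {n} (v : Vertex n) → InRange n (label {n} v)
label-in-range v = in-range (s≤s z≤n) (toℕ<n v)

label-injective : ∀ {n} {u v : Vertex n} → label {n} u ≡ label {n} v → u ≡ v
label-injective e = toℕ-injective (suc-injective e)

vertexAt-∈ : ∀ {n} (S : Subset (order n)) l (r : InRange n l) → inS S l ≡ true → vertexAt l r ∈ S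
vertexAt-∈ S l r e = memberAt⇒∈ S (vertexAt l r) (trans (cong (inS S) (label-vertexAt l r)) e)

vertexAt-∉ : ∀ {n} (S : Subset (order n)) l (r : InRange n l) → inS S l ≡ false → vertexAt l r ∉ S
vertexAt-∉ S l r e x∈S with trans (sym e) (trans (sym (cong (inS S) (label-vertexAt l r))) (∈⇒memberAt x∈S))
... | ()

LabelLTD : ℕ → (ℕ → Bool) → Set
LabelLTD n g =
  (∀ v → InRange n v → ∃ λ w → InRange n w × g w ≡ true × AdjL v w)
  ×
  (∀ u v → InRange n u → InRange n v → u ≢ v → g u ≡ false → g v ≡ false →
     ¬ (∀ w → InRange n w → g w ≡ true → (AdjL u w ⇔ AdjL v w)))

ltd⇒labelLTD : ∀ {n} {S : Subset (order n)} → IsLocTotDom n S → LabelLTD n (inS S)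
ltd⇒labelLTD {n} {S} (dom , loc) = dom′ , loc′
  where
  dom′ : ∀ v → InRange n v → ∃ λ w → InRange n w × inS S w ≡ true × AdjL v w
  dom′ v r with dom (vertexAt v r)
  ... | w , w∈S , adj =
    label {n} w , label-in-range w , ∈⇒memberAt w∈S , subst (λ l → AdjL l (label {n} w)) (label-vertexAt v r) adj
  loc′ : ∀ u v → InRange n u → InRange n v → u ≢ v → inS S u ≡ false → inS S v ≡ false →
         ¬ (∀ w → InRange n w → inS S w ≡ true → (AdjL u w ⇔ AdjL v w))
  loc′ u v ru rv u≢v u∉S v∉S same =
    loc (vertexAt u ru) (vertexAt v rv) distinct (vertexAt-∉ S u ru u∉S) (vertexAt-∉ S v rv v∉S) same′
    where
    distinct : vertexAt u ru ≢ vertexAt v rv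
    distinct e = u≢v (trans (sym (label-vertexAt u ru)) (trans (cong (label {n}) e) (label-vertexAt v rv)))
    same′ : ∀ w → w ∈ S →
      AdjL (label {n} (vertexAt {n} u ru)) (label {n} w) ⇔ AdjL (label {n} (vertexAt {n} v rv)) (label {n} w)
    same′ w w∈S =
      subst₂ (λ a b → AdjL a (label {n} w) ⇔ AdjL b (label {n} w))
        (sym (label-vertexAt u ru)) (sym (label-vertexAt v rv))
        (same (label {n} w) (label-in-range w) (∈⇒memberAt w∈S))

labelLTD⇒ltd : ∀ {n} (S : Subset (order n)) (g : ℕ → Bool) →
  (∀ v → InRange n v → inS S v ≡ g v) → LabelLTD n g → IsLocTotDom n S
labelLTD⇒ltd {n} S g agree (dom , loc) = dom′ , loc′
  where
  dom′ : (v : Vertex n) → ∃ λ u → u ∈ S × Adj n v u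
  dom′ v with dom (label {n} v) (label-in-range v)
  ... | w , rw , gw , adj =
    vertexAt w rw , vertexAt-∈ S w rw (trans (agree w rw) gw) , subst (AdjL (label {n} v)) (sym (label-vertexAt w rw)) adj
  outside : ∀ u → u ∉ S → g (label {n} u) ≡ false
  outside u u∉S = trans (sym (agree (label {n} u) (label-in-range u))) (∉⇒memberAt S u u∉S)
  loc′ : (u v : Vertex n) → u ≢ v → u ∉ S → v ∉ S → ¬ ((w : Vertex n) → w ∈ S → (Adj n u w ⇔ Adj n v w))
  loc′ u v u≢v u∉S v∉S same =
    loc (label {n} u) (label {n} v) (label-in-range u) (label-in-range v) (λ e → u≢v (label-injective {n} e))
        (outside u u∉S) (outside v v∉S) same′
    where
    same′ : ∀ w → InRange n w → g w ≡ true → (AdjL (label {n} u) w ⇔ AdjL (label {n} v) w)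
    same′ w rw gw =
      subst (λ l → AdjL (label {n} u) l ⇔ AdjL (label {n} v) l) (label-vertexAt w rw)
        (same (vertexAt w rw) (vertexAt-∈ S w rw (trans (agree w rw) gw)))

sumFrom : (ℕ → Bool) → ℕ → ℕ → ℕ
sumFrom f a zero = 0
sumFrom f a (suc m) = ⟦ f a ⟧ + sumFrom f (suc a) m

sumFrom-shift : ∀ f a m → sumFrom f (suc a) m ≡ sumFrom (f ∘′ suc) a m
sumFrom-shift f a zero = refl
sumFrom-shift f a (suc m) = cong (⟦ f (suc a) ⟧ +_) (sumFrom-shift f (suc a) m)

sumFrom-++ : ∀ f a m₁ m₂ → sumFrom f a (m₁ + m₂) ≡ sumFrom f a m₁ + sumFrom f (a + m₁) m₂
sumFrom-++ f a zero m₂ = cong (λ b → sumFrom f b m₂) (sym (+-identityʳ a))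
sumFrom-++ f a (suc m₁) m₂ = begin
  ⟦ f a ⟧ + sumFrom f (suc a) (m₁ + m₂)
    ≡⟨ cong (⟦ f a ⟧ +_) (sumFrom-++ f (suc a) m₁ m₂) ⟩
  ⟦ f a ⟧ + (sumFrom f (suc a) m₁ + sumFrom f (suc a + m₁) m₂)
    ≡⟨ sym (+-assoc ⟦ f a ⟧ _ _) ⟩
  ⟦ f a ⟧ + sumFrom f (suc a) m₁ + sumFrom f (suc a + m₁) m₂
    ≡⟨ cong (λ b → ⟦ f a ⟧ + sumFrom f (suc a) m₁ + sumFrom f b m₂) (sym (+-suc a m₁)) ⟩
  ⟦ f a ⟧ + sumFrom f (suc a) m₁ + sumFrom f (a + suc m₁) m₂ ∎
  where open ≡-Reasoning

sumFrom-cong : ∀ f g a m → (∀ v → a ≤ v → v < a + m → f v ≡ g v) → sumFrom f a m ≡ sumFrom g a m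
sumFrom-cong f g a zero agree = refl
sumFrom-cong f g a (suc m) agree =
  cong₂ _+_ (cong ⟦_⟧ (agree a ≤-refl (m<m+n a (s≤s z≤n))))
            (sumFrom-cong f g (suc a) m
               (λ v a<v v<end → agree v (<⇒≤ a<v) (subst (v <_) (sym (+-suc a m)) v<end)))

size-as-sum₀ : ∀ {m} (S : Subset m) → ∣ S ∣ ≡ sumFrom (memberAt S) 0 m
size-as-sum₀ [] = refl
size-as-sum₀ {suc m} (true ∷ S) = cong suc (trans (size-as-sum₀ S) (sym (sumFrom-shift (memberAt (true ∷ S)) 0 m)))
size-as-sum₀ {suc m} (false ∷ S) = trans (size-as-sum₀ S) (sym (sumFrom-shift (memberAt (false ∷ S)) 0 m))

size-as-sum : ∀ {m} (S : Subset m) → ∣ S ∣ ≡ sumFrom (inS S) 1 m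
size-as-sum {m} S = trans (size-as-sum₀ S) (sym (sumFrom-shift (inS S) 0 m))

subtreeCount : (ℕ → Bool) → ℕ → ℕ → ℕ
subtreeCount f x zero = ⟦ f x ⟧
subtreeCount f x (suc d) = ⟦ f x ⟧ + (subtreeCount f (2 * x) d + subtreeCount f (2 * x + 1) d)

-- Level j of the subtree below x is the interval of 2^j labels starting at 2^j x.
levelSum : (ℕ → Bool) → ℕ → ℕ → ℕ
levelSum f x j = sumFrom f (2 ^ j * x) (2 ^ j)

levelSum-children : ∀ f x j → levelSum f x (suc j) ≡ levelSum f (2 * x) j + levelSum f (2 * x + 1) j
levelSum-children f x j = begin
  sumFrom f (2 * P * x) (2 * P)           ≡⟨ cong₂ (sumFrom f) (left-start P x) (double P) ⟩
  sumFrom f (P * (2 * x)) (P + P)         ≡⟨ sumFrom-++ f (P * (2 * x)) P P ⟩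
  sumFrom f (P * (2 * x)) P + sumFrom f (P * (2 * x) + P) P
                                          ≡⟨ cong (λ b → sumFrom f (P * (2 * x)) P + sumFrom f b P) (right-start P x) ⟩
  sumFrom f (P * (2 * x)) P + sumFrom f (P * (2 * x + 1)) P ∎
  where
  open ≡-Reasoning
  P = 2 ^ j
  left-start : ∀ P x → 2 * P * x ≡ P * (2 * x)
  left-start = solve-∀
  double : ∀ P → 2 * P ≡ P + P
  double = solve-∀
  right-start : ∀ P x → P * (2 * x) + P ≡ P * (2 * x + 1)
  right-start = solve-∀

levelsSum : (ℕ → Bool) → ℕ → ℕ → ℕ
levelsSum f x zero = levelSum f x 0
levelsSum f x (suc d) = levelsSum f x d + levelSum f x (suc d)

levelSum-0 : ∀ f x → levelSum f x 0 ≡ ⟦ f x ⟧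
levelSum-0 f x = trans (cong (λ y → ⟦ f y ⟧ + 0) (*-identityˡ x)) (+-identityʳ _)

levelsSum-children : ∀ f x d →
  levelSum f x 0 + (levelsSum f (2 * x) d + levelsSum f (2 * x + 1) d) ≡ levelsSum f x (suc d)
levelsSum-children f x zero = cong (levelSum f x 0 +_) (sym (levelSum-children f x 0))
levelsSum-children f x (suc d) =
  trans (regroup (levelSum f x 0) (levelsSum f (2 * x) d) (levelSum f (2 * x) (suc d))
                 (levelsSum f (2 * x + 1) d) (levelSum f (2 * x + 1) (suc d)))
        (cong₂ _+_ (levelsSum-children f x d) (sym (levelSum-children f x (suc d))))
  where
  regroup : ∀ a b c d e → a + ((b + c) + (d + e)) ≡ (a + (b + d)) + (c + e)
  regroup = solve-∀

subtreeCount-levels : ∀ f d x → subtreeCount f x d ≡ levelsSum f x d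
subtreeCount-levels f zero x = sym (levelSum-0 f x)
subtreeCount-levels f (suc d) x =
  trans (cong₂ _+_ (sym (levelSum-0 f x))
                   (cong₂ _+_ (subtreeCount-levels f d (2 * x)) (subtreeCount-levels f d (2 * x + 1))))
        (levelsSum-children f x d)

-- The labels 1 … order (d+1) are the labels 1 … order d followed by level d+1.
order-split : ∀ P → 1 ≤ P → 2 * P ∸ 1 ≡ (P ∸ 1) + P
order-split (suc p) _ = cong (λ q → p + suc q) (+-identityʳ p)

levelsSum-root : ∀ f d → sumFrom f 1 (order d) ≡ levelsSum f 1 d
levelsSum-root f zero = refl
levelsSum-root f (suc d) = begin
  sumFrom f 1 (2 * P ∸ 1)                  ≡⟨ cong (sumFrom f 1) (order-split P P≥1) ⟩
  sumFrom f 1 ((P ∸ 1) + P)                ≡⟨ sumFrom-++ f 1 (P ∸ 1) P ⟩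
  sumFrom f 1 (P ∸ 1) + sumFrom f (1 + (P ∸ 1)) P
    ≡⟨ cong₂ _+_ (levelsSum-root f d)
                 (cong (λ b → sumFrom f b P) (trans (m+[n∸m]≡n P≥1) (sym (*-identityʳ P)))) ⟩
  levelsSum f 1 d + levelSum f 1 (suc d)  ∎
  where
  open ≡-Reasoning
  P = 2 ^ suc d
  P≥1 : 1 ≤ P
  P≥1 = m^n>0 2 (suc d)

sum-as-subtreeCount : ∀ f n → sumFrom f 1 (order n) ≡ subtreeCount f 1 n
sum-as-subtreeCount f n = trans (levelsSum-root f n) (sym (subtreeCount-levels f n 1))

subtreeCount-cong : ∀ f g x d → (∀ y → x ≤ y → f y ≡ g y) → subtreeCount f x d ≡ subtreeCount g x d
subtreeCount-cong f g x zero agree = cong ⟦_⟧ (agree x ≤-refl)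
subtreeCount-cong f g x (suc d) agree =
  cong₂ _+_ (cong ⟦_⟧ (agree x ≤-refl))
            (cong₂ _+_ (subtreeCount-cong f g (2 * x) d (λ y p → agree y (≤-trans (x≤2x x) p)))
                       (subtreeCount-cong f g (2 * x + 1) d (λ y p → agree y (≤-trans (x≤2x+1 x) p))))

sumAtDepth : (ℕ → ℕ) → ℕ → ℕ → ℕ
sumAtDepth g x zero = g x
sumAtDepth g x (suc j) = sumAtDepth g (2 * x) j + sumAtDepth g (2 * x + 1) j

subtreeCount-split : ∀ f j d x →
  subtreeCount f x (j + suc d) ≡ subtreeCount f x j + sumAtDepth (λ y → subtreeCount f y d) x (suc j)
subtreeCount-split f zero d x = refl
subtreeCount-split f (suc j) d x =
  trans (cong (⟦ f x ⟧ +_) (cong₂ _+_ (subtreeCount-split f j d (2 * x)) (subtreeCount-split f j d (2 * x + 1))))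
        (regroup ⟦ f x ⟧ (subtreeCount f (2 * x) j) (sumAtDepth below (2 * x) (suc j))
                 (subtreeCount f (2 * x + 1) j) (sumAtDepth below (2 * x + 1) (suc j)))
  where
  below : ℕ → ℕ
  below y = subtreeCount f y d
  regroup : ∀ a b c d e → a + ((b + c) + (d + e)) ≡ (a + (b + d)) + (c + e)
  regroup = solve-∀

Inherited : (ℕ → ℕ → Set) → Set
Inherited P = ∀ {j y} → P (suc j) y → P j (2 * y) × P j (2 * y + 1)

doubling : ∀ j h → 2 ^ suc j * h ≡ 2 ^ j * h + 2 ^ j * h
doubling j h = trans (*-assoc 2 (2 ^ j) h) (cong (2 ^ j * h +_) (+-identityʳ (2 ^ j * h)))

sumAtDepth-≥ : ∀ (P : ℕ → ℕ → Set) → Inherited P → ∀ g h → (∀ {y} → P 0 y → h ≤ g y) →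
  ∀ j {x} → P j x → 2 ^ j * h ≤ sumAtDepth g x j
sumAtDepth-≥ P inherit g h bound zero {x} px = subst (_≤ g x) (sym (*-identityˡ h)) (bound px)
sumAtDepth-≥ P inherit g h bound (suc j) {x} px =
  subst (_≤ sumAtDepth g (2 * x) j + sumAtDepth g (2 * x + 1) j) (sym (doubling j h))
    (+-mono-≤ (sumAtDepth-≥ P inherit g h bound j (proj₁ (inherit px)))
              (sumAtDepth-≥ P inherit g h bound j (proj₂ (inherit px))))

sumAtDepth-≡ : ∀ (P : ℕ → ℕ → Set) → Inherited P → ∀ g h → (∀ {y} → P 0 y → g y ≡ h) →
  ∀ j {x} → P j x → sumAtDepth g x j ≡ 2 ^ j * h
sumAtDepth-≡ P inherit g h value zero px = trans (value px) (sym (*-identityˡ h))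
sumAtDepth-≡ P inherit g h value (suc j) px =
  trans (cong₂ _+_ (sumAtDepth-≡ P inherit g h value j (proj₁ (inherit px)))
                   (sumAtDepth-≡ P inherit g h value j (proj₂ (inherit px))))
        (sym (doubling j h))

-- A block is a vertex x (indicator a), its children
-- 2x, 2x+1 (b, b′) and its grandchildren 4x, 4x+1 (c₁, c₂), 4x+2, 4x+3 (c₃, c₄).
one≤⟦⟧ : ∀ {p} → p ≡ true → 1 ≤ ⟦ p ⟧
one≤⟦⟧ refl = s≤s z≤n

one-of-three : ∀ p q r → p ≡ true ⊎ q ≡ true ⊎ r ≡ true → 1 ≤ ⟦ p ⟧ + (⟦ q ⟧ + ⟦ r ⟧)
one-of-three p q r (inj₁ e) = ≤-trans (one≤⟦⟧ e) (m≤m+n ⟦ p ⟧ _)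
one-of-three p q r (inj₂ (inj₁ e)) = ≤-trans (≤-trans (one≤⟦⟧ e) (m≤m+n ⟦ q ⟧ ⟦ r ⟧)) (m≤n+m _ ⟦ p ⟧)
one-of-three p q r (inj₂ (inj₂ e)) = ≤-trans (≤-trans (one≤⟦⟧ e) (m≤n+m ⟦ r ⟧ ⟦ q ⟧)) (m≤n+m _ ⟦ p ⟧)

one-of-six : ∀ b b′ c₁ c₂ c₃ c₄ →
  (b ≡ false → b′ ≡ false → c₁ ≡ false → c₂ ≡ false → c₃ ≡ false → c₄ ≡ false → ⊥) →
  1 ≤ (⟦ b ⟧ + (⟦ c₁ ⟧ + ⟦ c₂ ⟧)) + (⟦ b′ ⟧ + (⟦ c₃ ⟧ + ⟦ c₄ ⟧))
one-of-six true _ _ _ _ _ _ = s≤s z≤n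
one-of-six false _ true _ _ _ _ = s≤s z≤n
one-of-six false _ false true _ _ _ = s≤s z≤n
one-of-six false true false false _ _ _ = s≤s z≤n
one-of-six false false false false true _ _ = s≤s z≤n
one-of-six false false false false false true _ = s≤s z≤n
one-of-six false false false false false false none = ⊥-elim (none refl refl refl refl refl refl)

-- A block contains two members as soon as 2x is dominated (by x, 2x+1, 4x or 4x+1),
-- 2x+1 is dominated (by x, 2x, 4x+2 or 4x+3), and x is not the only member of the block.
two-of-seven : ∀ a b b′ c₁ c₂ c₃ c₄ →
  a ≡ true ⊎ b′ ≡ true ⊎ c₁ ≡ true ⊎ c₂ ≡ true →
  a ≡ true ⊎ b ≡ true ⊎ c₃ ≡ true ⊎ c₄ ≡ true →
  (a ≡ true → b ≡ false → b′ ≡ false → c₁ ≡ false → c₂ ≡ false → c₃ ≡ false → c₄ ≡ false → ⊥) →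
  2 ≤ ⟦ a ⟧ + ((⟦ b ⟧ + (⟦ c₁ ⟧ + ⟦ c₂ ⟧)) + (⟦ b′ ⟧ + (⟦ c₃ ⟧ + ⟦ c₄ ⟧)))
two-of-seven true b b′ c₁ c₂ c₃ c₄ _ _ not-alone = s≤s (one-of-six b b′ c₁ c₂ c₃ c₄ (not-alone refl))
two-of-seven false b b′ c₁ c₂ c₃ c₄ (inj₁ ()) _ _
two-of-seven false b b′ c₁ c₂ c₃ c₄ (inj₂ _) (inj₁ ()) _
two-of-seven false b b′ c₁ c₂ c₃ c₄ (inj₂ left) (inj₂ right) _ =
  subst (2 ≤_) (exchange ⟦ b′ ⟧ (⟦ c₁ ⟧ + ⟦ c₂ ⟧) ⟦ b ⟧ (⟦ c₃ ⟧ + ⟦ c₄ ⟧))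
    (+-mono-≤ (one-of-three b′ c₁ c₂ left) (one-of-three b c₃ c₄ right))
  where
  exchange : ∀ p q r s → (p + q) + (r + s) ≡ (r + q) + (p + s)
  exchange = solve-∀

-- β k = (2^(3k+4) - 2)/7: the minimum number of members below a vertex at height 3k+1.
subtreeMin : ℕ → ℕ
subtreeMin zero = 2
subtreeMin (suc k) = 2 + 8 * subtreeMin k

module LowerBound (n : ℕ) (S : Subset (order n)) (ltd : IsLocTotDom n S) where

  member : ℕ → Bool
  member = inS S

  dominated : ∀ v → InRange n v → ∃ λ w → InRange n w × member w ≡ true × AdjL v w
  dominated = proj₁ (ltd⇒labelLTD ltd)

  located : ∀ u v → InRange n u → InRange n v → u ≢ v → member u ≡ false → member v ≡ false →
    ¬ (∀ w → InRange n w → member w ≡ true → (AdjL u w ⇔ AdjL v w))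
  located = proj₂ (ltd⇒labelLTD ltd)

  present : ∀ {w l} → member w ≡ true → w ≡ l → member l ≡ true
  present mw refl = mw

  conflict : ∀ {w l} → member w ≡ true → member l ≡ false → w ≡ l → ⊥
  conflict mw fl refl with trans (sym mw) fl
  ... | ()

  -- Every block with 2x+1 in ST_n contains at least two members of S: 2x and 2x+1 must be
  -- dominated, and if x were the only member then N(2x) ∩ S = {x} = N(2x+1) ∩ S, so 2x and
  -- 2x+1 (both outside S) could not be located.
  block : ∀ x → 1 ≤ x → 2 * x + 1 ≤ order n → 2 ≤ subtreeCount member x 2
  block x px r =
    two-of-seven (member x) (member g) (member g′) (member (2 * g)) (member (2 * g + 1))
                 (member (2 * g′)) (member (2 * g′ + 1))
      left-dominated right-dominated parent-not-alone
    where
    g = 2 * x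
    g′ = 2 * x + 1
    rg : InRange n g
    rg = in-range (1≤2x px) (≤-trans (m≤m+n g 1) r)
    rg′ : InRange n g′
    rg′ = in-range (1≤2x+1 x) r
    left-dominated :
      member x ≡ true ⊎ member g′ ≡ true ⊎ member (2 * g) ≡ true ⊎ member (2 * g + 1) ≡ true
    left-dominated with dominated g rg
    ... | w , _ , mw , adj = ⊎-map (present mw) (⊎-map (present mw) (⊎-map (present mw) (present mw)))
                                   (nbr-even x w adj)
    right-dominated :
      member x ≡ true ⊎ member g ≡ true ⊎ member (2 * g′) ≡ true ⊎ member (2 * g′ + 1) ≡ true
    right-dominated with dominated g′ rg′
    ... | w , _ , mw , adj = ⊎-map (present mw) (⊎-map (present mw) (⊎-map (present mw) (present mw)))
                                   (nbr-odd x w adj)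
    parent-not-alone : member x ≡ true → member g ≡ false → member g′ ≡ false →
                       member (2 * g) ≡ false → member (2 * g + 1) ≡ false →
                       member (2 * g′) ≡ false → member (2 * g′ + 1) ≡ false → ⊥
    parent-not-alone _ mg mg′ m₁ m₂ m₃ m₄ = located g g′ rg rg′ (even≢odd′ x x) mg mg′ same
      where
      same : ∀ w → InRange n w → member w ≡ true → (AdjL g w ⇔ AdjL g′ w)
      same w _ mw = mk⇔ to from
        where
        to : AdjL g w → AdjL g′ w
        to a with nbr-even x w a
        ... | inj₁ refl = inj₁ (inj₂ refl)
        ... | inj₂ (inj₁ e) = ⊥-elim (conflict mw mg′ e)
        ... | inj₂ (inj₂ (inj₁ e)) = ⊥-elim (conflict mw m₁ e)
        ... | inj₂ (inj₂ (inj₂ e)) = ⊥-elim (conflict mw m₂ e)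
        from : AdjL g′ w → AdjL g w
        from a with nbr-odd x w a
        ... | inj₁ refl = inj₁ (inj₁ refl)
        ... | inj₂ (inj₁ e) = ⊥-elim (conflict mw mg e)
        ... | inj₂ (inj₂ (inj₁ e)) = ⊥-elim (conflict mw m₃ e)
        ... | inj₂ (inj₂ (inj₂ e)) = ⊥-elim (conflict mw m₄ e)

  root-dominated : 1 ≤ subtreeCount member 1 1
  root-dominated with dominated 1 (in-range (s≤s z≤n) (1≤order n))
  ... | w , in-range w≥1 _ , mw , adj =
    one-of-three (member 1) (member 2) (member 3) (inj₂ (⊎-map (present mw) (present mw) (nbr-root w w≥1 adj)))

  beyond-absent : ∀ {y} → ReachesLevel (suc n) 0 y → ⟦ member y ⟧ ≡ 0
  beyond-absent {y} r = cong ⟦_⟧ (memberAt-beyond S (y ∸ 1) (∸-monoˡ-≤ 1 (reaches-beyond r)))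

  right-child-in-range : ∀ {e x} → ReachesLevel n (suc e) x → 2 * x + 1 ≤ order n
  right-child-in-range r = reaches-in-range (proj₂ (reaches-children r))

  -- A vertex at height 3k+1 has at least β k members of S in its subtree: the top block
  -- contributes 2 and each of the 8 subtrees three levels down contributes β (k-1); at height 1
  -- the grandchildren of the block do not exist.
  subtree-bound : ∀ k x → ReachesLevel n (1 + k * 3) x → subtreeMin k ≤ subtreeCount member x (1 + k * 3)

  descendants-bound : ∀ k j {x} → ReachesLevel n (j + (1 + k * 3)) x →
    2 ^ j * subtreeMin k ≤ sumAtDepth (λ y → subtreeCount member y (1 + k * 3)) x j
  descendants-bound k j = sumAtDepth-≥ (λ i → ReachesLevel n (i + (1 + k * 3))) reaches-children
                            (λ y → subtreeCount member y (1 + k * 3)) (subtreeMin k) (subtree-bound k _) j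

  subtree-bound zero x r@(px , h) =
    subst (2 ≤_) (trans (subtreeCount-split member 1 0 x)
                        (trans (cong (subtreeCount member x 1 +_) leaves-below) (+-identityʳ _)))
          (block x px (right-child-in-range r))
    where
    leaves-below : sumAtDepth (λ y → ⟦ member y ⟧) x 2 ≡ 0
    leaves-below = sumAtDepth-≡ (ReachesLevel (suc n)) reaches-children (λ y → ⟦ member y ⟧) 0 beyond-absent 2
                     (px , trans (+-suc (level x) 1) (cong suc h))
  subtree-bound (suc k) x r@(px , _) =
    subst (2 + 8 * subtreeMin k ≤_) (sym (subtreeCount-split member 2 (1 + k * 3) x))
      (+-mono-≤ (block x px (right-child-in-range r)) (descendants-bound k 3 r))

data Mod3 : ℕ → Set where
  mod3≡1 : ∀ k → Mod3 (1 + k * 3)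
  mod3≡2 : ∀ k → Mod3 (2 + k * 3)
  mod3≡0 : ∀ k → Mod3 (3 + k * 3)

mod3 : ∀ n → 1 ≤ n → Mod3 n
mod3 (suc zero) _ = mod3≡1 0
mod3 (suc (suc m)) _ with mod3 (suc m) (s≤s z≤n)
... | mod3≡1 k = mod3≡2 k
... | mod3≡2 k = mod3≡0 k
... | mod3≡0 k = mod3≡1 (suc k)

optimum : ∀ {n} → Mod3 n → ℕ
optimum (mod3≡1 k) = subtreeMin k
optimum (mod3≡2 k) = 2 * subtreeMin k
optimum (mod3≡0 k) = 1 + 4 * subtreeMin k

-- At the root: for n = 3k+1 use subtree-bound directly; for n = 3k+2 the two children are at
-- height 3k+1; for n = 3k+3 the four grandchildren are, and the root contributes one more
-- member among 1, 2, 3 because it has to be dominated.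
root-lower-bound : ∀ n (r : Mod3 n) (S : Subset (order n)) → IsLocTotDom n S →
  optimum r ≤ subtreeCount (inS S) 1 n
root-lower-bound n (mod3≡1 k) S ltd = subtree-bound k 1 (reaches-root n)
  where open LowerBound n S ltd
root-lower-bound n (mod3≡2 k) S ltd =
  subst (2 * subtreeMin k ≤_) (sym (subtreeCount-split member 0 (1 + k * 3) 1))
    (≤-trans (descendants-bound k 1 (reaches-root n)) (m≤n+m _ ⟦ member 1 ⟧))
  where open LowerBound n S ltd
root-lower-bound n (mod3≡0 k) S ltd =
  subst (1 + 4 * subtreeMin k ≤_) (sym (subtreeCount-split member 1 (1 + k * 3) 1))
    (+-mono-≤ root-dominated (descendants-bound k 2 (reaches-root n)))
  where open LowerBound n S ltd

lower-bound : ∀ n (r : Mod3 n) (S : Subset (order n)) → IsLocTotDom n S → optimum r ≤ ∣ S ∣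
lower-bound n r S ltd =
  subst (optimum r ≤_) (sym (trans (size-as-sum S) (sum-as-subtreeCount (inS S) n))) (root-lower-bound n r S ltd)

subtreeMin-closed : ∀ k → 7 * subtreeMin k + 2 ≡ 2 ^ (1 + k * 3 + 3)
subtreeMin-closed zero = refl
subtreeMin-closed (suc k) =
  trans (step (subtreeMin k)) (cong (λ p → 2 * (2 * (2 * p))) (subtreeMin-closed k))
  where
  step : ∀ m → 7 * (2 + 8 * m) + 2 ≡ 2 * (2 * (2 * (7 * m + 2)))
  step = solve-∀

formula-from : ∀ n q r → n % 3 ≡ r → 2 ^ (n + 3) ≡ q * 7 + correction r → formula n ≡ q
formula-from n q r residue power = begin
  (2 ^ (n + 3) ∸ correction (n % 3)) / 7  ≡⟨ cong (λ s → (2 ^ (n + 3) ∸ correction s) / 7) residue ⟩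
  (2 ^ (n + 3) ∸ correction r) / 7        ≡⟨ cong (λ p → (p ∸ correction r) / 7) power ⟩
  (q * 7 + correction r ∸ correction r) / 7 ≡⟨ cong (_/ 7) (m+n∸n≡m (q * 7) (correction r)) ⟩
  q * 7 / 7                               ≡⟨ m*n/n≡m q 7 ⟩
  q                                       ∎
  where open ≡-Reasoning

formula≡optimum : ∀ {n} (r : Mod3 n) → formula n ≡ optimum r
formula≡optimum (mod3≡1 k) =
  formula-from (1 + k * 3) (subtreeMin k) 1 ([m+kn]%n≡m%n 1 k 3)
    (trans (sym (subtreeMin-closed k)) (swap (subtreeMin k)))
  where
  swap : ∀ m → 7 * m + 2 ≡ m * 7 + 2
  swap = solve-∀
formula≡optimum (mod3≡2 k) =
  formula-from (2 + k * 3) (2 * subtreeMin k) 2 ([m+kn]%n≡m%n 2 k 3)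
    (trans (cong (2 *_) (sym (subtreeMin-closed k))) (double (subtreeMin k)))
  where
  double : ∀ m → 2 * (7 * m + 2) ≡ 2 * m * 7 + 4
  double = solve-∀
formula≡optimum (mod3≡0 k) =
  formula-from (3 + k * 3) (1 + 4 * subtreeMin k) 0 ([m+kn]%n≡m%n 3 k 3)
    (trans (cong (λ p → 2 * (2 * p)) (sym (subtreeMin-closed k))) (quadruple (subtreeMin k)))
  where
  quadruple : ∀ m → 2 * (2 * (7 * m + 2)) ≡ (1 + 4 * m) * 7 + 1
  quadruple = solve-∀

data Pattern : Set where
  full left empty : Pattern

next : Pattern → Pattern
next full = left
next left = empty
next empty = full

next^ : ℕ → Pattern → Pattern
next^ zero p = p
next^ (suc j) p = next^ j (next p)

full≢left : full ≢ left
full≢left ()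

empty≢left : empty ≢ left
empty≢left ()

next≡left : ∀ p → next p ≡ left → p ≡ full
next≡left full _ = refl

cycle : ℕ → Pattern
cycle zero = full
cycle (suc m) = next (cycle m)

cycle-3k : ∀ k → cycle (k * 3) ≡ full
cycle-3k zero = refl
cycle-3k (suc k) = cong (next ∘′ next ∘′ next) (cycle-3k k)

-- patternOf n v: the pattern of the level of v.  Since level v + 2n + 1 ≡ level v - n + 1
-- (mod 3), the leaves are a left level, the level above them empty, the next one full, etc.
patternOf : ℕ → ℕ → Pattern
patternOf n v = cycle (level v + suc (2 * n))

isEven : ℕ → Bool
isEven zero = true
isEven (suc k) = not (isEven k)

isEven-double : ∀ c → isEven (2 * c) ≡ true
isEven-double zero = refl
isEven-double (suc c) = trans (cong isEven (double-suc c)) (cong (not ∘′ not) (isEven-double c))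

isEven-double+1 : ∀ c → isEven (2 * c + 1) ≡ false
isEven-double+1 c = trans (cong isEven (odd-form c)) (cong not (isEven-double c))

admits : Pattern → ℕ → Bool
admits full _ = true
admits left v = isEven v
admits empty _ = false

admits-left-child : ∀ p c → p ≢ left → admits (next p) (2 * c) ≡ true
admits-left-child full c _ = isEven-double c
admits-left-child left c p≢left = ⊥-elim (p≢left refl)
admits-left-child empty c _ = refl

-- The construction: vertices selected by the pattern of their level, together with vertex 2
-- when the root level is a left level (n ≡ 0 mod 3), since then nothing else dominates the root.
isLeft : Pattern → Bool
isLeft left = true
isLeft _ = false

base : ℕ → ℕ → Bool
base n v = admits (patternOf n v) v

construction : ℕ → ℕ → Bool
construction n v = base n v ∨ (isLeft (patternOf n 1) ∧ (v ≡ᵇ 2))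

Sn : (n : ℕ) → Subset (order n)
Sn n = tabulate (λ i → construction n (label {n} i))

patternOf-root : ∀ n → patternOf n 1 ≡ cycle (suc (2 * n))
patternOf-root n = cong (λ l → cycle (l + suc (2 * n))) level-1

patternOf-leaf : ∀ n v → level v ≡ n → patternOf n v ≡ left
patternOf-leaf n v e =
  trans (cong (λ l → cycle (l + suc (2 * n))) e) (trans (cong cycle (rotate n)) (cong next (cycle-3k n)))
  where
  rotate : ∀ n → n + suc (2 * n) ≡ suc (n * 3)
  rotate = solve-∀

patternOf-child : ∀ n c v → 1 ≤ c → v ≡ 2 * c ⊎ v ≡ 2 * c + 1 → patternOf n v ≡ next (patternOf n c)
patternOf-child n c v pc (inj₁ refl) = cong (λ l → cycle (l + suc (2 * n))) (level-double c pc)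
patternOf-child n c v pc (inj₂ refl) = cong (λ l → cycle (l + suc (2 * n))) (level-double+1 c pc)

record PatternAt (n : ℕ) (p : Pattern) (j y : ℕ) : Set where
  constructor patternAt
  field
    positive : 1 ≤ y
    below    : next^ j (patternOf n y) ≡ p

patternOf-inherited : ∀ n p → Inherited (PatternAt n p)
patternOf-inherited n p {j} {y} (patternAt py e) =
  patternAt (1≤2x py) (trans (cong (next^ j) (patternOf-child n y (2 * y) py (inj₁ refl))) e) ,
  patternAt (1≤2x+1 y) (trans (cong (next^ j) (patternOf-child n y (2 * y + 1) py (inj₂ refl))) e)

non-leaf : ∀ n v → InRange n v → patternOf n v ≢ left → 2 * v + 1 ≤ order n
non-leaf n v (in-range v≥1 v≤) not-left =
  child-in-range n v v≥1 (≤∧≢⇒< (in-range⇒level≤ n v v≤) (λ e → not-left (patternOf-leaf n v e)))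

base⇒construction : ∀ n w → base n w ≡ true → construction n w ≡ true
base⇒construction n w e = cong (_∨ (isLeft (patternOf n 1) ∧ (w ≡ᵇ 2))) e

construction⇒base : ∀ n w → construction n w ≡ false → base n w ≡ false
construction⇒base n w e = ∨-conicalˡ (base n w) _ e

construction-above-2 : ∀ n z → 3 ≤ z → construction n z ≡ base n z
construction-above-2 n (suc zero) (s≤s ())
construction-above-2 n (suc (suc zero)) (s≤s (s≤s ()))
construction-above-2 n (suc (suc (suc z))) _ =
  trans (cong (base n (3 + z) ∨_) (∧-zeroʳ (isLeft (patternOf n 1)))) (∨-identityʳ (base n (3 + z)))

construction-plain : ∀ n → isLeft (patternOf n 1) ≡ false → ∀ z → construction n z ≡ base n z
construction-plain n e z = trans (cong (λ b → base n z ∨ (b ∧ (z ≡ᵇ 2))) e) (∨-identityʳ (base n z))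

module ConstructionCount (n : ℕ) where

  admitted : ∀ y {p} → patternOf n y ≡ p → ⟦ base n y ⟧ ≡ ⟦ admits p y ⟧
  admitted y e = cong (λ p → ⟦ admits p y ⟧) e

  full-top : ∀ x → 1 ≤ x → patternOf n x ≡ full → subtreeCount (base n) x 1 ≡ 2
  full-top x px e =
    cong₂ _+_ (admitted x e)
      (cong₂ _+_ (trans (admitted (2 * x) (child (inj₁ refl))) (cong ⟦_⟧ (isEven-double x)))
                 (trans (admitted (2 * x + 1) (child (inj₂ refl))) (cong ⟦_⟧ (isEven-double+1 x))))
    where
    child : ∀ {v} → v ≡ 2 * x ⊎ v ≡ 2 * x + 1 → patternOf n v ≡ left
    child side = trans (patternOf-child n x _ px side) (cong next e)

  -- A full vertex at height 3k+1 has exactly β k members of base n below it: its block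
  -- contains 2 members (the grandchildren are empty), and the 8 vertices three levels down
  -- are full again.
  full-count : ∀ k x → 1 ≤ x → patternOf n x ≡ full → subtreeCount (base n) x (1 + k * 3) ≡ subtreeMin k

  full-descendants : ∀ k j {x} → PatternAt n full j x →
    sumAtDepth (λ y → subtreeCount (base n) y (1 + k * 3)) x j ≡ 2 ^ j * subtreeMin k
  full-descendants k j = sumAtDepth-≡ (PatternAt n full) (patternOf-inherited n full)
                           (λ y → subtreeCount (base n) y (1 + k * 3)) (subtreeMin k)
                           (λ (patternAt py e) → full-count k _ py e) j

  full-count zero x px e = full-top x px e
  full-count (suc k) x px e = begin
    subtreeCount (base n) x (1 + suc k * 3)
      ≡⟨ subtreeCount-split (base n) 2 (1 + k * 3) x ⟩
    subtreeCount (base n) x 2 + sumAtDepth (λ y → subtreeCount (base n) y (1 + k * 3)) x 3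
      ≡⟨ cong₂ _+_ block (full-descendants k 3 {x} (patternAt px (cong (next^ 3) e))) ⟩
    2 + 8 * subtreeMin k ∎
    where
    open ≡-Reasoning
    empty-grandchildren : sumAtDepth (λ y → ⟦ base n y ⟧) x 2 ≡ 0
    empty-grandchildren = sumAtDepth-≡ (PatternAt n empty) (patternOf-inherited n empty) (λ y → ⟦ base n y ⟧) 0
                            (λ {y} (patternAt _ e′) → admitted y e′) 2 {x} (patternAt px (cong (next^ 2) e))
    block : subtreeCount (base n) x 2 ≡ 2
    block = trans (subtreeCount-split (base n) 1 0 x) (cong₂ _+_ (full-top x px e) empty-grandchildren)

-- The construction has exactly the optimum number of members: the root is full (n = 3k+1),
-- empty with two full children (n = 3k+2), or left with four full grandchildren and the extra
-- vertex 2 as the only member of the top two levels (n = 3k+3).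
construction-count : ∀ n (r : Mod3 n) → subtreeCount (construction n) 1 n ≡ optimum r
construction-count n (mod3≡1 k) =
  trans (subtreeCount-cong (construction n) (base n) 1 n (λ z _ → construction-plain n (cong isLeft root) z))
        (full-count k 1 (s≤s z≤n) root)
  where
  open ConstructionCount n
  rotate : ∀ k → suc (2 * (1 + k * 3)) ≡ suc (2 * k) * 3
  rotate = solve-∀
  root : patternOf n 1 ≡ full
  root = trans (patternOf-root n) (trans (cong cycle (rotate k)) (cycle-3k (suc (2 * k))))
construction-count n (mod3≡2 k) = begin
  subtreeCount (construction n) 1 n
    ≡⟨ subtreeCount-cong (construction n) (base n) 1 n (λ z _ → construction-plain n (cong isLeft root) z) ⟩
  subtreeCount (base n) 1 n
    ≡⟨ subtreeCount-split (base n) 0 (1 + k * 3) 1 ⟩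
  ⟦ base n 1 ⟧ + sumAtDepth (λ y → subtreeCount (base n) y (1 + k * 3)) 1 1
    ≡⟨ cong₂ _+_ (admitted 1 root) (full-descendants k 1 {1} (patternAt (s≤s z≤n) (cong next root))) ⟩
  2 * subtreeMin k ∎
  where
  open ≡-Reasoning
  open ConstructionCount n
  rotate : ∀ k → suc (2 * (2 + k * 3)) ≡ suc (suc (suc (2 * k) * 3))
  rotate = solve-∀
  root : patternOf n 1 ≡ empty
  root = trans (patternOf-root n) (trans (cong cycle (rotate k)) (cong (next ∘′ next) (cycle-3k (suc (2 * k)))))
construction-count n (mod3≡0 k) = begin
  subtreeCount (construction n) 1 n
    ≡⟨ subtreeCount-split (construction n) 1 (1 + k * 3) 1 ⟩
  subtreeCount (construction n) 1 1 + sumAtDepth (λ y → subtreeCount (construction n) y (1 + k * 3)) 1 2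
    ≡⟨ cong₂ _+_ top (cong₂ _+_ (cong₂ _+_ (below-2 4 3≤) (below-2 5 3≤))
                                (cong₂ _+_ (below-2 6 3≤) (below-2 7 3≤))) ⟩
  1 + sumAtDepth (λ y → subtreeCount (base n) y (1 + k * 3)) 1 2
    ≡⟨ cong (1 +_) (full-descendants k 2 {1} (patternAt (s≤s z≤n) (cong (next^ 2) root))) ⟩
  1 + 4 * subtreeMin k ∎
  where
  open ≡-Reasoning
  open ConstructionCount n
  rotate : ∀ k → suc (2 * (3 + k * 3)) ≡ suc (suc (suc (2 * k)) * 3)
  rotate = solve-∀
  root : patternOf n 1 ≡ left
  root = trans (patternOf-root n) (trans (cong cycle (rotate k)) (cong next (cycle-3k (suc (suc (2 * k))))))
  children : ∀ {v} → v ≡ 2 ⊎ v ≡ 3 → patternOf n v ≡ empty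
  children side = trans (patternOf-child n 1 _ (s≤s z≤n) side) (cong next root)
  top : subtreeCount (construction n) 1 1 ≡ 1
  top = cong₂ _+_ (cong (λ p → ⟦ admits p 1 ∨ (isLeft p ∧ false) ⟧) root)
          (cong₂ _+_ (cong₂ (λ p q → ⟦ admits q 2 ∨ (isLeft p ∧ true) ⟧) root (children (inj₁ refl)))
                     (cong₂ (λ p q → ⟦ admits q 3 ∨ (isLeft p ∧ false) ⟧) root (children (inj₂ refl))))
  3≤ : ∀ {y} → 3 ≤ 3 + y
  3≤ {y} = m≤m+n 3 y
  below-2 : ∀ y → 3 ≤ y → subtreeCount (construction n) y (1 + k * 3) ≡ subtreeCount (base n) y (1 + k * 3)
  below-2 y y≥3 = subtreeCount-cong (construction n) (base n) y (1 + k * 3)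
                      (λ z y≤z → construction-above-2 n z (≤-trans y≥3 y≤z))

module ConstructionLTD (n : ℕ) (n≥1 : 1 ≤ n) where

  member : ℕ → Bool
  member = construction n

  absurd-member : ∀ w → member w ≡ false → base n w ≡ true → ⊥
  absurd-member w out inside with trans (sym inside) (construction⇒base n w out)
  ... | ()

  children-member : ∀ v → 1 ≤ v → patternOf n v ≢ left → member (2 * v) ≡ true
  children-member v pv not-left =
    base⇒construction n (2 * v)
      (trans (cong (λ p → admits p (2 * v)) (patternOf-child n v (2 * v) pv (inj₁ refl)))
             (admits-left-child (patternOf n v) v not-left))

  full-member : ∀ w → patternOf n w ≡ full → member w ≡ true
  full-member w e = base⇒construction n w (cong (λ p → admits p w) e)

  parent-full : ∀ c v → 1 ≤ c → v ≡ 2 * c ⊎ v ≡ 2 * c + 1 → patternOf n v ≡ left → patternOf n c ≡ full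
  parent-full c v pc side e = next≡left (patternOf n c) (trans (sym (patternOf-child n c v pc side)) e)

  parent-in-range : ∀ c v → 1 ≤ c → v ≡ 2 * c ⊎ v ≡ 2 * c + 1 → InRange n v → InRange n c
  parent-in-range c v pc (inj₁ refl) (in-range _ v≤) = in-range pc (≤-trans (x≤2x c) v≤)
  parent-in-range c v pc (inj₂ refl) (in-range _ v≤) = in-range pc (≤-trans (x≤2x+1 c) v≤)

  -- Domination: a vertex on a full or empty level is dominated by its left child, a non-root
  -- vertex on a left level by its (full) parent, and the root on a left level by vertex 2.
  by-child : ∀ v → InRange n v → patternOf n v ≢ left → ∃ λ w → InRange n w × member w ≡ true × AdjL v w
  by-child v r@(in-range v≥1 _) not-left =
    2 * v , in-range (1≤2x v≥1) (≤-trans (m≤m+n (2 * v) 1) (non-leaf n v r not-left)) ,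
    children-member v v≥1 not-left , inj₂ (inj₁ (inj₁ refl))

  dominated : ∀ v → InRange n v → ∃ λ w → InRange n w × member w ≡ true × AdjL v w
  dominated v r@(in-range v≥1 _) with patternOf n v in eq
  ... | full = by-child v r (λ e → full≢left (trans (sym eq) e))
  ... | empty = by-child v r (λ e → empty≢left (trans (sym eq) e))
  ... | left with halve v
  ...   | zero , inj₁ refl = ⊥-elim (1+n≰n v≥1)
  ...   | zero , inj₂ refl = 2 , in-range (s≤s z≤n) (two≤order n n≥1) , extra , inj₂ (inj₁ (inj₁ refl))
    where
    extra : member 2 ≡ true
    extra = trans (cong (λ p → base n 2 ∨ (isLeft p ∧ true)) eq) (∨-zeroʳ (base n 2))
  ...   | suc c , side =
    suc c , parent-in-range (suc c) v (s≤s z≤n) side r ,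
    full-member (suc c) (parent-full (suc c) v (s≤s z≤n) side eq) , inj₁ side

  Follows : ℕ → ℕ → Set
  Follows u v = ∀ w → InRange n w → member w ≡ true → AdjL u w → AdjL v w

  -- Every vertex outside the construction other than the root is determined by its member
  -- neighbours: on an empty level by its two (full) children, whose only common neighbour it
  -- is; on a left level it is a right child 2c+1, the only common neighbour of its full parent
  -- c and its member sibling 2c.
  identified-by : ∀ p u → patternOf n u ≡ p → InRange n u → u ≢ 1 → member u ≡ false →
    ∀ v → Follows u v → v ≡ u
  identified-by full u eq _ _ out _ _ = ⊥-elim (absurd-member u out (cong (λ p → admits p u) eq))
  identified-by empty u eq r@(in-range u≥1 _) _ _ v follows =
    common-nbr-siblings u v u≥1
      (follows (2 * u) left-range (children-member u u≥1 not-left) (inj₂ (inj₁ (inj₁ refl))))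
      (follows (2 * u + 1) right-range right-member (inj₂ (inj₁ (inj₂ refl))))
    where
    not-left : patternOf n u ≢ left
    not-left e = empty≢left (trans (sym eq) e)
    left-range : InRange n (2 * u)
    left-range = in-range (1≤2x u≥1) (≤-trans (m≤m+n (2 * u) 1) (non-leaf n u r not-left))
    right-range : InRange n (2 * u + 1)
    right-range = in-range (1≤2x+1 u) (non-leaf n u r not-left)
    right-member : member (2 * u + 1) ≡ true
    right-member = full-member (2 * u + 1) (trans (patternOf-child n u (2 * u + 1) u≥1 (inj₂ refl)) (cong next eq))
  identified-by left u eq r u≢1 out v follows with halve u
  ... | c , inj₁ refl =
    ⊥-elim (absurd-member (2 * c) out (trans (cong (λ p → admits p (2 * c)) eq) (isEven-double c)))
  ... | zero , inj₂ refl = ⊥-elim (u≢1 refl)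
  ... | suc c , inj₂ refl =
    common-nbr-parent-left (suc c) v pc
      (follows (suc c) (parent-in-range (suc c) u pc (inj₂ refl) r) (full-member (suc c) parent) (inj₁ (inj₂ refl)))
      (follows (2 * suc c) sibling-range (children-member (suc c) pc (λ e → full≢left (trans (sym parent) e)))
               (inj₂ (inj₂ (inj₂ (suc c , pc , refl , refl)))))
    where
    pc : 1 ≤ suc c
    pc = s≤s z≤n
    parent : patternOf n (suc c) ≡ full
    parent = parent-full (suc c) u pc (inj₂ refl) eq
    sibling-range : InRange n (2 * suc c)
    sibling-range = in-range (1≤2x pc) (≤-trans (m≤m+n (2 * suc c) 1) (InRange.bounded r))

  identified : ∀ u → InRange n u → u ≢ 1 → member u ≡ false → ∀ v → Follows u v → v ≡ u
  identified u = identified-by (patternOf n u) u refl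

  -- Location: two distinct non-members cannot both be the root, and a non-root non-member is
  -- identified by its member neighbours.
  located : ∀ u v → InRange n u → InRange n v → u ≢ v → member u ≡ false → member v ≡ false →
    ¬ (∀ w → InRange n w → member w ≡ true → (AdjL u w ⇔ AdjL v w))
  located u v ru rv u≢v out-u out-v same with u ≟ 1
  ... | no u≢1 = u≢v (sym (identified u ru u≢1 out-u v (λ w rw mw → Equivalence.to (same w rw mw))))
  ... | yes refl =
    u≢v (identified v rv (λ v≡1 → u≢v (sym v≡1)) out-v 1 (λ w rw mw → Equivalence.from (same w rw mw)))

  labelLTD : LabelLTD n member
  labelLTD = dominated , located

Sn-agrees : ∀ n v → InRange n v → inS (Sn n) v ≡ construction n v
Sn-agrees n (suc k) (in-range _ p) =
  trans (memberAt-tabulate (λ i → construction n (label {n} i)) k p)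
        (cong (construction n ∘′ suc) (toℕ-fromℕ< p))

Sn-ltd : ∀ n → 1 ≤ n → IsLocTotDom n (Sn n)
Sn-ltd n n≥1 = labelLTD⇒ltd (Sn n) (construction n) (Sn-agrees n) (ConstructionLTD.labelLTD n n≥1)

Sn-size : ∀ n (r : Mod3 n) → ∣ Sn n ∣ ≡ optimum r
Sn-size n r = begin
  ∣ Sn n ∣                             ≡⟨ size-as-sum (Sn n) ⟩
  sumFrom (inS (Sn n)) 1 (order n)     ≡⟨ sumFrom-cong (inS (Sn n)) (construction n) 1 (order n)
                                            (λ v v≥1 v< → Sn-agrees n v (in-range v≥1 (≤-pred v<))) ⟩
  sumFrom (construction n) 1 (order n) ≡⟨ sum-as-subtreeCount (construction n) n ⟩
  subtreeCount (construction n) 1 n    ≡⟨ construction-count n r ⟩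
  optimum r                            ∎
  where open ≡-Reasoning

theorem8 : (n : ℕ) → 1 ≤ n → LocTotDomNumber n (formula n)
theorem8 n n≥1 =
  (Sn n , Sn-ltd n n≥1 , trans (Sn-size n r) (sym (formula≡optimum r))) ,
  λ S ltd → subst (_≤ ∣ S ∣) (sym (formula≡optimum r)) (lower-bound n r S ltd)
  where
  r : Mod3 n
  r = mod3 n n≥1
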